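{- Let $(s(0,k))_{k\in\mathbb{Z}}$ be an arbitrary sequence of real numbers such that $s(0,k)\neq 0$ for only finitely many $k$. Given $\alpha,\beta\in\mathbb{R}$, define $s(n,k)$ recursively for $n\ge 1$ and $k\in\mathbb{Z}$ by \[ s(n,k)=\alpha\, s(n-1,k-1)+\beta\, s(n-1,k)+\alpha\, s(n-1,k+1). \] Fix $k_0\in\mathbb{Z}$ and $k_1\in\mathbb{N}$, and define, for $n\ge 0$, \[ d_n=\sum_{j=-\infty}^{\infty}\Bigl[s(n,k_0-5j)-s(n,k_0-5j-k_1)\Bigr]. \] Then for all $n\ge 2$, \[ d_n=(2\beta-\alpha)\,d_{n-1}+(\alpha\beta+\alpha^2-\beta^2)\,d_{n-2}. \]
   Context: The sums defining $d_n$ are finite, since each row $(s(n,k))_k$ has only finitely many nonzero entries. -}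

module Defs where

open import Algebra.Bundles using (CommutativeRing)
open import Data.Nat as ℕ using (ℕ; zero; suc)
open import Data.Integer as ℤ using (ℤ; +_; -[1+_]; ∣_∣)
open import Data.Product using (∃; _,_)

module _ {c ℓ} (R : CommutativeRing c ℓ) where
  open CommutativeRing R

  sub : Carrier → Carrier → Carrier
  sub x y = x + (- y)

  FinSupp : (ℤ → Carrier) → Set ℓ
  FinSupp f = ∃ λ (N : ℕ) → ∀ (k : ℤ) → N ℕ.< ∣ k ∣ → f k ≈ 0#

  s : (α β : Carrier) → (s0 : ℤ → Carrier) → ℕ → ℤ → Carrier
  s α β s0 zero    k = s0 k
  s α β s0 (suc n) k =
    α * s α β s0 n (k ℤ.- ℤ.1ℤ) + β * s α β s0 n k + α * s α β s0 n (k ℤ.+ ℤ.1ℤ)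

  symSum : (ℤ → Carrier) → ℕ → Carrier
  symSum f zero    = f (+ 0)
  symSum f (suc M) = symSum f M + f (+ suc M) + f -[1+ M ]

  -- Σ_{j ∈ ℤ} f j = x  (the symmetric partial sums are eventually equal to x;
  -- for finitely supported f this is exactly the finite sum)
  HasSum : (ℤ → Carrier) → Carrier → Set ℓ
  HasSum f x = ∃ λ (N : ℕ) → ∀ (M : ℕ) → N ℕ.≤ M → symSum f M ≈ x

  dTerm : (α β : Carrier) → (s0 : ℤ → Carrier) → (k0 : ℤ) → (k1 : ℕ) → ℕ → ℤ → Carrier
  dTerm α β s0 k0 k1 n j =
    sub (s α β s0 n (k0 ℤ.- + 5 ℤ.* j)) (s α β s0 n (k0 ℤ.- + 5 ℤ.* j ℤ.- + k1))

-- Unfolding the recursion twice gives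
--   s(n+2,k) = (2β - α) s(n+1,k) + (αβ + α² - β²) s(n,k) + α² (s(n,k-2) + ⋯ + s(n,k+2)).
-- Along an arithmetic progression k ≡ k₀ (mod 5) these five-term windows tile ℤ, so their sum is the
-- total sum of s(n,·) whatever k₀ is, and in d_{n+2} the window terms at k₀ and at k₀ - k₁ cancel.
-- Moving the window by one step changes the sum by a telescoping series of a finitely supported
-- sequence, which is how the cancellation is proved.
module Submission where

open import Defs
open import Algebra.Bundles using (CommutativeRing)
open import Data.Maybe using (Maybe; just; nothing)
open import Data.Nat as ℕ using (ℕ; zero; suc; _∸_)
import Data.Nat.Properties as ℕP
open import Data.Integer as ℤ using (ℤ; +_; -[1+_]; ∣_∣; 1ℤ; -1ℤ; _⊖_)
import Data.Integer.Properties as ℤP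
open import Data.Integer.Tactic.RingSolver using (solve-∀)
open import Data.Product using (_,_)
open import Function using (_∘_)
open import Relation.Binary.PropositionalEquality as ≡ using (_≡_)
open import Relation.Nullary using (yes; no)

-- Ring solver for an arbitrary commutative ring, with ℤ as coefficients: the
-- solver needs coefficients whose arithmetic computes in order to cancel terms.
module IntegerCoefficients {c ℓ} (R : CommutativeRing c ℓ) where
  open CommutativeRing R
  open import Algebra.Properties.Ring ring using (-‿involutive; -0#≈0#; -‿distribˡ-*; -‿distribʳ-*)
  open import Algebra.Properties.AbelianGroup +-abelianGroup using (⁻¹-∙-comm; xyx⁻¹≈y)
  open import Algebra.Properties.Semiring.Mult semiring using (_×_; ×-homo-+; ×1-homo-*)
  open import Algebra.Solver.Ring.AlmostCommutativeRing
  open import Relation.Binary.Reasoning.Setoid setoid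

  ⟦_⟧ : ℤ → Carrier
  ⟦ + n ⟧      = n × 1#
  ⟦ -[1+ n ] ⟧ = - (suc n × 1#)

  ⟦-⟧ : ∀ i → ⟦ ℤ.- i ⟧ ≈ - ⟦ i ⟧
  ⟦-⟧ (+ zero)  = sym -0#≈0#
  ⟦-⟧ (+ suc n) = refl
  ⟦-⟧ -[1+ n ]  = sym (-‿involutive _)

  ⟦⊖⟧ : ∀ m n → ⟦ m ⊖ n ⟧ ≈ m × 1# - n × 1#
  ⟦⊖⟧ m zero rewrite ℤP.⊖-≥ {m} {0} ℕ.z≤n = sym (trans (+-congˡ -0#≈0#) (+-identityʳ _))
  ⟦⊖⟧ zero (suc n) = sym (+-identityˡ _)
  ⟦⊖⟧ (suc m) (suc n) rewrite ℤP.[1+m]⊖[1+n]≡m⊖n m n = begin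
    ⟦ m ⊖ n ⟧                            ≈⟨ ⟦⊖⟧ m n ⟩
    a - b                                ≈⟨ xyx⁻¹≈y 1# (a - b) ⟨
    1# + (a - b) - 1#                    ≈⟨ +-congʳ (+-assoc 1# a (- b)) ⟨
    1# + a + - b + - 1#                  ≈⟨ +-assoc _ _ _ ⟩
    1# + a + (- b + - 1#)                ≈⟨ +-congˡ (trans (+-comm _ _) (⁻¹-∙-comm 1# b)) ⟩
    1# + a - (1# + b)                    ∎
    where a = m × 1#; b = n × 1#

  ⟦+⟧ : ∀ i j → ⟦ i ℤ.+ j ⟧ ≈ ⟦ i ⟧ + ⟦ j ⟧
  ⟦+⟧ -[1+ m ] -[1+ n ] = begin
    - (1# + (1# + (m ℕ.+ n) × 1#))       ≈⟨ -‿cong (+-congˡ (+-congˡ (×-homo-+ 1# m n))) ⟩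
    - (1# + (1# + (a + b)))              ≈⟨ -‿cong (+-congˡ (+-comm _ _)) ⟩
    - (1# + ((a + b) + 1#))              ≈⟨ -‿cong (+-congˡ (+-assoc _ _ _)) ⟩
    - (1# + (a + (b + 1#)))              ≈⟨ -‿cong (+-assoc _ _ _) ⟨
    - ((1# + a) + (b + 1#))              ≈⟨ -‿cong (+-congˡ (+-comm _ _)) ⟩
    - ((1# + a) + (1# + b))              ≈⟨ ⁻¹-∙-comm _ _ ⟨
    - (1# + a) + - (1# + b)              ∎
    where a = m × 1#; b = n × 1#
  ⟦+⟧ -[1+ m ] (+ n)    = trans (⟦⊖⟧ n (suc m)) (+-comm _ _)
  ⟦+⟧ (+ m)    -[1+ n ] = ⟦⊖⟧ m (suc n)
  ⟦+⟧ (+ m)    (+ n)    = ×-homo-+ 1# m n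

  ⟦+*+⟧ : ∀ m n → ⟦ + m ℤ.* + n ⟧ ≈ m × 1# * n × 1#
  ⟦+*+⟧ m n rewrite ≡.sym (ℤP.pos-* m n) = ×1-homo-* m n

  ⟦*⟧ : ∀ i j → ⟦ i ℤ.* j ⟧ ≈ ⟦ i ⟧ * ⟦ j ⟧
  ⟦*⟧ (+ m) (+ n) = ⟦+*+⟧ m n
  ⟦*⟧ (+ m) -[1+ n ] = begin
    ⟦ + m ℤ.* ℤ.- + suc n ⟧              ≡⟨ ≡.cong ⟦_⟧ (ℤP.neg-distribʳ-* (+ m) (+ suc n)) ⟨
    ⟦ ℤ.- (+ m ℤ.* + suc n) ⟧            ≈⟨ ⟦-⟧ (+ m ℤ.* + suc n) ⟩
    - ⟦ + m ℤ.* + suc n ⟧                ≈⟨ -‿cong (⟦+*+⟧ m (suc n)) ⟩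
    - (m × 1# * suc n × 1#)              ≈⟨ -‿distribʳ-* _ _ ⟩
    m × 1# * - (suc n × 1#)              ∎
  ⟦*⟧ -[1+ m ] (+ n) = begin
    ⟦ ℤ.- + suc m ℤ.* + n ⟧              ≡⟨ ≡.cong ⟦_⟧ (ℤP.neg-distribˡ-* (+ suc m) (+ n)) ⟨
    ⟦ ℤ.- (+ suc m ℤ.* + n) ⟧            ≈⟨ ⟦-⟧ (+ suc m ℤ.* + n) ⟩
    - ⟦ + suc m ℤ.* + n ⟧                ≈⟨ -‿cong (⟦+*+⟧ (suc m) n) ⟩
    - (suc m × 1# * n × 1#)              ≈⟨ -‿distribˡ-* _ _ ⟩
    - (suc m × 1#) * n × 1#              ∎
  ⟦*⟧ -[1+ m ] -[1+ n ] = begin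
    ⟦ + suc m ℤ.* + suc n ⟧              ≈⟨ ⟦+*+⟧ (suc m) (suc n) ⟩
    a * b                                ≈⟨ -‿involutive _ ⟨
    - - (a * b)                          ≈⟨ -‿cong (-‿distribˡ-* a b) ⟩
    - (- a * b)                          ≈⟨ -‿distribʳ-* _ _ ⟩
    - a * - b                            ∎
    where a = suc m × 1#; b = suc n × 1#

  ⟦⟧-morphism : ℤ.+-*-rawRing -Raw-AlmostCommutative⟶ fromCommutativeRing R
  ⟦⟧-morphism = record
    { ⟦_⟧ = ⟦_⟧ ; +-homo = ⟦+⟧ ; *-homo = ⟦*⟧ ; -‿homo = ⟦-⟧
    ; 0-homo = refl ; 1-homo = +-identityʳ 1# }

  ⟦⟧-≟ : ∀ i j → Maybe (⟦ i ⟧ ≈ ⟦ j ⟧)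
  ⟦⟧-≟ i j with i ℤ.≟ j
  ... | yes ≡.refl = just refl
  ... | no _       = nothing

  open import Algebra.Solver.Ring ℤ.+-*-rawRing (fromCommutativeRing R) ⟦⟧-morphism ⟦⟧-≟ public
    using (solve; _:+_; _:-_; _:*_; :-_; _:=_)

module _ {c ℓ} (R : CommutativeRing c ℓ) where
  open CommutativeRing R
  open IntegerCoefficients R using (solve; _:+_; _:-_; _:*_; _:=_)
  open import Relation.Binary.Reasoning.Setoid setoid

  symSum-cong : ∀ {f g} → (∀ j → f j ≈ g j) → ∀ M → symSum R f M ≈ symSum R g M
  symSum-cong f≈g zero    = f≈g _
  symSum-cong f≈g (suc M) = +-cong (+-cong (symSum-cong f≈g M) (f≈g _)) (f≈g _)

  symSum-+ : ∀ f g M → symSum R (λ j → f j + g j) M ≈ symSum R f M + symSum R g M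
  symSum-+ f g zero    = refl
  symSum-+ f g (suc M) = trans (+-congʳ (+-congʳ (symSum-+ f g M)))
    (solve 6 (λ a b c d e h → a :+ b :+ (c :+ d) :+ (e :+ h) := a :+ c :+ e :+ (b :+ d :+ h))
      refl _ _ _ _ _ _)

  symSum-*ˡ : ∀ a f M → symSum R (λ j → a * f j) M ≈ a * symSum R f M
  symSum-*ˡ a f zero    = refl
  symSum-*ˡ a f (suc M) = trans (+-congʳ (+-congʳ (symSum-*ˡ a f M)))
    (solve 4 (λ a x y z → a :* x :+ a :* y :+ a :* z := a :* (x :+ y :+ z)) refl _ _ _ _)

  symSum-telescope : ∀ h M → symSum R (λ j → h j - h (j ℤ.+ 1ℤ)) M ≈ h (ℤ.- + M) - h (+ suc M)
  symSum-telescope h zero    = refl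
  symSum-telescope h (suc M) = begin
    symSum R (λ j → h j - h (j ℤ.+ 1ℤ)) M + (h (+ suc M) - h (+ suc M ℤ.+ 1ℤ))
      + (h -[1+ M ] - h (-[1+ M ] ℤ.+ 1ℤ))
      ≈⟨ +-cong (+-cong (symSum-telescope h M) (+-congˡ (-‿cong (h-cong (+1-+1 M)))))
                (+-congˡ (-‿cong (h-cong (-1-+1 (+ M))))) ⟩
    h (ℤ.- + M) - h (+ suc M) + (h (+ suc M) - h (+ suc (suc M))) + (h -[1+ M ] - h (ℤ.- + M))
      ≈⟨ solve 4 (λ a b c d → a :- b :+ (b :- c) :+ (d :- a) := d :- c) refl _ _ _ _ ⟩
    h -[1+ M ] - h (+ suc (suc M)) ∎
    where
    h-cong : ∀ {i j} → i ≡ j → h i ≈ h j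
    h-cong = reflexive ∘ ≡.cong h
    +1-+1 : ∀ m → + suc m ℤ.+ 1ℤ ≡ + suc (suc m)
    +1-+1 m = ≡.cong (+_ ∘ suc) (ℕP.+-comm m 1)
    -1-+1 : ∀ i → ℤ.- (1ℤ ℤ.+ i) ℤ.+ 1ℤ ≡ ℤ.- i
    -1-+1 = solve-∀

  hasSum-cong : ∀ {f g x y} → (∀ j → f j ≈ g j) → x ≈ y → HasSum R f x → HasSum R g y
  hasSum-cong f≈g x≈y (N , sum) = N , λ M N≤M → trans (sym (symSum-cong f≈g M)) (trans (sum M N≤M) x≈y)

  hasSum-+ : ∀ {f g x y} → HasSum R f x → HasSum R g y → HasSum R (λ j → f j + g j) (x + y)
  hasSum-+ {f} {g} (N₁ , sum₁) (N₂ , sum₂) = N₁ ℕ.⊔ N₂ , λ M N≤M →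
    trans (symSum-+ f g M)
      (+-cong (sum₁ M (ℕP.≤-trans (ℕP.m≤m⊔n N₁ N₂) N≤M)) (sum₂ M (ℕP.≤-trans (ℕP.m≤n⊔m N₁ N₂) N≤M)))

  hasSum-*ˡ : ∀ a {f x} → HasSum R f x → HasSum R (λ j → a * f j) (a * x)
  hasSum-*ˡ a {f} (N , sum) = N , λ M N≤M → trans (symSum-*ˡ a f M) (*-congˡ (sum M N≤M))

  hasSum-unique : ∀ {f x y} → HasSum R f x → HasSum R f y → x ≈ y
  hasSum-unique (N₁ , sum₁) (N₂ , sum₂) =
    trans (sym (sum₁ M (ℕP.m≤m⊔n N₁ N₂))) (sum₂ M (ℕP.m≤n⊔m N₁ N₂))
    where M = N₁ ℕ.⊔ N₂

  hasSum-zero : ∀ {f} → (∀ j → f j ≈ 0#) → HasSum R f 0#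
  hasSum-zero {f} f≈0 = 0 , λ M _ → symSum-zero M
    where
    symSum-zero : ∀ M → symSum R f M ≈ 0#
    symSum-zero zero    = f≈0 _
    symSum-zero (suc M) =
      trans (+-cong (+-cong (symSum-zero M) (f≈0 _)) (f≈0 _)) (trans (+-identityʳ _) (+-identityʳ 0#))

  finSupp-+ : ∀ {f g} → FinSupp R f → FinSupp R g → FinSupp R (λ k → f k + g k)
  finSupp-+ (N₁ , vanish₁) (N₂ , vanish₂) = N₁ ℕ.⊔ N₂ , λ k N<k →
    trans (+-cong (vanish₁ k (ℕP.m⊔n<o⇒m<o N₁ N₂ N<k)) (vanish₂ k (ℕP.m⊔n<o⇒n<o N₁ N₂ N<k)))
          (+-identityʳ 0#)

  finSupp-*ˡ : ∀ a {f} → FinSupp R f → FinSupp R (λ k → a * f k)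
  finSupp-*ˡ a (N , vanish) = N , λ k N<k → trans (*-congˡ (vanish k N<k)) (zeroʳ a)

  finSupp-shift : ∀ {f} → FinSupp R f → ∀ i → FinSupp R (λ k → f (k ℤ.+ i))
  finSupp-shift (N , vanish) i = N ℕ.+ ∣ i ∣ , λ k N+i<k →
    vanish (k ℤ.+ i) (ℕP.+-cancelʳ-< ∣ i ∣ N _ (ℕP.<-≤-trans N+i<k (∣k∣≤ k)))
    where
    k+i-i : ∀ k i → k ℤ.+ i ℤ.- i ≡ k
    k+i-i = solve-∀
    ∣k∣≤ : ∀ k → ∣ k ∣ ℕ.≤ ∣ k ℤ.+ i ∣ ℕ.+ ∣ i ∣
    ∣k∣≤ k = ≡.subst (λ j → ∣ j ∣ ℕ.≤ ∣ k ℤ.+ i ∣ ℕ.+ ∣ i ∣) (k+i-i k i) (ℤP.∣i-j∣≤∣i∣+∣j∣ (k ℤ.+ i) i)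

  finSupp-neg : ∀ {f} → FinSupp R f → FinSupp R (λ k → f (ℤ.- k))
  finSupp-neg (N , vanish) = N , λ k N<k →
    vanish (ℤ.- k) (≡.subst (N ℕ.<_) (≡.sym (ℤP.∣-i∣≡∣i∣ k)) N<k)

  finSupp-scale : ∀ {f} → FinSupp R f → ∀ m → FinSupp R (λ k → f (+ suc m ℤ.* k))
  finSupp-scale (N , vanish) m = N , λ k N<k →
    vanish (+ suc m ℤ.* k)
      (≡.subst (N ℕ.<_) (≡.sym (ℤP.abs-* (+ suc m) k)) (ℕP.<-≤-trans N<k (ℕP.m≤n*m ∣ k ∣ (suc m))))

  hasSum-telescope : ∀ {h} → FinSupp R h → HasSum R (λ j → h j - h (j ℤ.+ 1ℤ)) 0#
  hasSum-telescope {h} (N , vanish) = suc N , λ M N<M → begin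
    symSum R (λ j → h j - h (j ℤ.+ 1ℤ)) M ≈⟨ symSum-telescope h M ⟩
    h (ℤ.- + M) - h (+ suc M)              ≈⟨ +-cong (vanish _ (≡.subst (N ℕ.<_) (≡.sym (ℤP.∣-i∣≡∣i∣ (+ M))) N<M))
                                                       (-‿cong (vanish _ (ℕP.m<n⇒m<1+n N<M))) ⟩
    0# - 0#                                ≈⟨ -‿inverseʳ 0# ⟩
    0#                                     ∎

  window₅ : (ℤ → Carrier) → ℤ → Carrier
  window₅ f k = f (k ℤ.- 1ℤ ℤ.- 1ℤ) + f (k ℤ.- 1ℤ) + f k + f (k ℤ.+ 1ℤ) + f (k ℤ.+ 1ℤ ℤ.+ 1ℤ)

  window₅-sub-pred : ∀ f k → window₅ f k - window₅ f (k ℤ.- 1ℤ) ≈ f (k ℤ.+ 1ℤ ℤ.+ 1ℤ) - f (k ℤ.- 1ℤ ℤ.- 1ℤ ℤ.- 1ℤ)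
  window₅-sub-pred f k = trans
    (+-congˡ (-‿cong (+-cong (+-congˡ (f-cong (-1+1 k))) (f-cong (-1+1+1 k)))))
    (solve 6 (λ a b c d e z → a :+ b :+ c :+ d :+ e :- (z :+ a :+ b :+ c :+ d) := e :- z) refl _ _ _ _ _ _)
    where
    f-cong : ∀ {i j} → i ≡ j → f i ≈ f j
    f-cong = reflexive ∘ ≡.cong f
    -1+1 : ∀ k → k ℤ.- 1ℤ ℤ.+ 1ℤ ≡ k
    -1+1 = solve-∀
    -1+1+1 : ∀ k → k ℤ.- 1ℤ ℤ.+ 1ℤ ℤ.+ 1ℤ ≡ k ℤ.+ 1ℤ
    -1+1+1 = solve-∀

  hasSum-window₅-shift : ∀ {f} → FinSupp R f → ∀ k₀ t →
    HasSum R (λ j → window₅ f (k₀ ℤ.- + 5 ℤ.* j) - window₅ f (k₀ ℤ.- + 5 ℤ.* j ℤ.- + t)) 0#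
  hasSum-window₅-shift {f} f-fin k₀ zero =
    hasSum-zero λ j → trans (+-congˡ (-‿cong (W-cong (ℤP.+-identityʳ _)))) (-‿inverseʳ _)
    where
    W-cong : ∀ {i j} → i ≡ j → window₅ f i ≈ window₅ f j
    W-cong = reflexive ∘ ≡.cong (window₅ f)
  hasSum-window₅-shift {f} f-fin k₀ (suc t) =
    hasSum-cong split (+-identityʳ 0#)
      (hasSum-+ (hasSum-window₅-shift f-fin k₀ t) (hasSum-cong step refl (hasSum-telescope h-fin)))
    where
    W = window₅ f
    X : ℤ → ℤ
    X j = k₀ ℤ.- + 5 ℤ.* j
    centre : ℤ
    centre = k₀ ℤ.- + t ℤ.+ + 2
    h : ℤ → Carrier
    h j = f (ℤ.- (+ 5 ℤ.* j) ℤ.+ centre)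
    h-fin : FinSupp R h
    h-fin = finSupp-scale (finSupp-neg (finSupp-shift f-fin centre)) 4

    split : ∀ j → W (X j) - W (X j ℤ.- + t) + (W (X j ℤ.- + t) - W (X j ℤ.- + suc t))
                ≈ W (X j) - W (X j ℤ.- + suc t)
    split j = solve 3 (λ a b c → a :- b :+ (b :- c) := a :- c) refl _ _ _

    sub-suc : ∀ x u → x ℤ.- (1ℤ ℤ.+ u) ≡ x ℤ.- u ℤ.- 1ℤ
    sub-suc = solve-∀
    top : ∀ k₀ j u → k₀ ℤ.- + 5 ℤ.* j ℤ.- u ℤ.+ 1ℤ ℤ.+ 1ℤ ≡ ℤ.- (+ 5 ℤ.* j) ℤ.+ (k₀ ℤ.- u ℤ.+ + 2)
    top = solve-∀
    bottom : ∀ k₀ j u → k₀ ℤ.- + 5 ℤ.* j ℤ.- u ℤ.- 1ℤ ℤ.- 1ℤ ℤ.- 1ℤ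
                      ≡ ℤ.- (+ 5 ℤ.* (j ℤ.+ 1ℤ)) ℤ.+ (k₀ ℤ.- u ℤ.+ + 2)
    bottom = solve-∀

    step : ∀ j → h j - h (j ℤ.+ 1ℤ) ≈ W (X j ℤ.- + t) - W (X j ℤ.- + suc t)
    step j = sym (begin
      W (X j ℤ.- + t) - W (X j ℤ.- + suc t)
        ≡⟨ ≡.cong (λ k → W (X j ℤ.- + t) - W k) (sub-suc (X j) (+ t)) ⟩
      W (X j ℤ.- + t) - W (X j ℤ.- + t ℤ.- 1ℤ)
        ≈⟨ window₅-sub-pred f (X j ℤ.- + t) ⟩
      f (X j ℤ.- + t ℤ.+ 1ℤ ℤ.+ 1ℤ) - f (X j ℤ.- + t ℤ.- 1ℤ ℤ.- 1ℤ ℤ.- 1ℤ)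
        ≡⟨ ≡.cong₂ (λ a b → f a - f b) (top k₀ j (+ t)) (bottom k₀ j (+ t)) ⟩
      h j - h (j ℤ.+ 1ℤ) ∎)

  module _ (α β : Carrier) (s₀ : ℤ → Carrier) where

    s-finSupp : FinSupp R s₀ → ∀ n → FinSupp R (s R α β s₀ n)
    s-finSupp s₀-fin zero    = s₀-fin
    s-finSupp s₀-fin (suc n) =
      finSupp-+ (finSupp-+ (finSupp-*ˡ α (finSupp-shift prev -1ℤ)) (finSupp-*ˡ β prev))
                (finSupp-*ˡ α (finSupp-shift prev 1ℤ))
      where prev = s-finSupp s₀-fin n

    s-suc-suc : ∀ n k → s R α β s₀ (suc (suc n)) k
      ≈ (β + β - α) * s R α β s₀ (suc n) k + (α * β + α * α - β * β) * s R α β s₀ n k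
        + α * α * window₅ (s R α β s₀ n) k
    s-suc-suc n k = trans
      (+-cong (+-congʳ (*-congˡ (+-congˡ (*-congˡ (S-cong (-1+1 k))))))
              (*-congˡ (+-congʳ (+-congʳ (*-congˡ (S-cong (+1-1 k)))))))
      (solve 7 (λ α β a b c d e →
          α :* (α :* a :+ β :* b :+ α :* c) :+ β :* (α :* b :+ β :* c :+ α :* d)
            :+ α :* (α :* c :+ β :* d :+ α :* e)
        := (β :+ β :- α) :* (α :* b :+ β :* c :+ α :* d) :+ (α :* β :+ α :* α :- β :* β) :* c
            :+ α :* α :* (a :+ b :+ c :+ d :+ e))
        refl α β _ _ _ _ _)
      where
      S-cong : ∀ {i j} → i ≡ j → s R α β s₀ n i ≈ s R α β s₀ n j
      S-cong = reflexive ∘ ≡.cong (s R α β s₀ n)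
      -1+1 : ∀ k → k ℤ.- 1ℤ ℤ.+ 1ℤ ≡ k
      -1+1 = solve-∀
      +1-1 : ∀ k → k ℤ.+ 1ℤ ℤ.- 1ℤ ≡ k
      +1-1 = solve-∀

    dTerm-suc-suc : ∀ k₀ k₁ n j → dTerm R α β s₀ k₀ k₁ (suc (suc n)) j
      ≈ (β + β - α) * dTerm R α β s₀ k₀ k₁ (suc n) j + (α * β + α * α - β * β) * dTerm R α β s₀ k₀ k₁ n j
        + α * α * (window₅ (s R α β s₀ n) (k₀ ℤ.- + 5 ℤ.* j)
                   - window₅ (s R α β s₀ n) (k₀ ℤ.- + 5 ℤ.* j ℤ.- + k₁))
    dTerm-suc-suc k₀ k₁ n j = trans (+-cong (s-suc-suc n _) (-‿cong (s-suc-suc n _)))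
      (solve 9 (λ a b e p q r p′ q′ r′ →
          a :* p :+ b :* q :+ e :* r :- (a :* p′ :+ b :* q′ :+ e :* r′)
        := a :* (p :- p′) :+ b :* (q :- q′) :+ e :* (r :- r′))
        refl _ _ _ _ _ _ _ _ _)

mainTheorem2 : ∀ {c ℓ} (R : CommutativeRing c ℓ) →
    let open CommutativeRing R in
    (α β : Carrier) (s0 : ℤ → Carrier) → FinSupp R s0 →
    (k0 : ℤ) (k1 : ℕ) (d : ℕ → Carrier) →
    (∀ (n : ℕ) → HasSum R (dTerm R α β s0 k0 k1 n) (d n)) →
    ∀ (n : ℕ) → 2 ℕ.≤ n →
    d n ≈ sub R (β + β) α * d (n ∸ 1)
    + sub R (α * β + α * α) (β * β) * d (n ∸ 2)
mainTheorem2 R α β s0 s0-fin k0 k1 d d-sum (suc (suc n)) (ℕ.s≤s (ℕ.s≤s _)) =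
  trans (hasSum-unique R (d-sum (suc (suc n))) recurrence-sum)
        (trans (+-congˡ (zeroʳ (α * α))) (+-identityʳ _))
  where
  open CommutativeRing R
  recurrence-sum : HasSum R (dTerm R α β s0 k0 k1 (suc (suc n)))
    (sub R (β + β) α * d (suc n) + sub R (α * β + α * α) (β * β) * d n + α * α * 0#)
  recurrence-sum = hasSum-cong R (λ j → sym (dTerm-suc-suc R α β s0 k0 k1 n j)) refl
    (hasSum-+ R (hasSum-+ R (hasSum-*ˡ R _ (d-sum (suc n))) (hasSum-*ˡ R _ (d-sum n)))
                (hasSum-*ˡ R _ (hasSum-window₅-shift R (s-finSupp R α β s0 s0-fin n) k0 k1)))
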